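{- Let $G$ be a labeled complete graph, $0<\gamma<\alpha<1/2$, and $x$ a fractional clustering of $G$, and run Algorithm R (described in the context). Suppose that at some iteration, with current vertex set $S$ and pivot $u$, the cluster $\{u\}\cup T$ is output because $\sum_{w\in T}x_{uw}<\alpha|T|/2$. Then for every $z\in S\setminus(\{u\}\cup T)$, the number of $+$ edges from $z$ to $\{u\}\cup T$ is at most $\max\{1/(1-2\alpha),\,2/\alpha\}$ times $\sum_{w\in(\{u\}\cup T)\cap N^+(z)}x_{wz}+\sum_{w\in(\{u\}\cup T)\cap N^-(z)}(1-x_{wz})$.
   Context: A labeled complete graph has every edge labeled $+$ or $-$; $N^+(v)$, $N^-(v)$ are the $+$ and $-$ neighborhoods. A fractional clustering is a vector $x$ indexed by unordered pairs of distinct vertices with $x_{uv}\in[0,1]$ and $x_{vz}\le x_{vw}+x_{wz}$ for all distinct $v,w,z$; $x_{uu}=0$. Algorithm R: Set $S=V(G)$. While $S\neq\emptyset$: for each $u\in S$ let $T_u=\{w\in S\setminus\{u\}: x_{uw}\le\alpha\}$ and $T^*_u=\{w\in S\setminus\{u\}: x_{uw}\le\gamma\}$; choose a pivot $u\in S$ maximizing $|T^*_u|$; let $T=T_u$. If $\sum_{w\in T}x_{uw}\ge\alpha|T|/2$, output the cluster $\{u\}$ and set $S=S\setminus\{u\}$; otherwise output the cluster $\{u\}\cup T$ and set $S=S\setminus(\{u\}\cup T)$.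
   Formalization: The fractional clustering x and the parameters α and γ take rational values. -}

module Defs where

open import Data.Bool using (Bool; true; false; if_then_else_; _∧_; not)
open import Data.Nat as ℕ using (ℕ)
open import Data.Fin using (Fin; _≟_)
open import Data.List using (List; []; _∷_; foldr; map; length; filterᵇ; allFin)
open import Data.Integer using (+_)
open import Data.Rational using (ℚ; 0ℚ; 1ℚ; _+_; _*_; _-_; _/_; _≤_; _<_; _⊔_; 1/_; _÷_; >-nonZero)
open import Data.Rational.Properties using (_≤?_; _<?_)
open import Relation.Nullary using (yes; no)
open import Relation.Nullary.Decidable using (⌊_⌋)
open import Relation.Binary.PropositionalEquality using (_≡_)

ℕ→ℚ : ℕ → ℚ
ℕ→ℚ n = + n / 1

Σ[_]_ : ∀ {A : Set} → List A → (A → ℚ) → ℚ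
Σ[ xs ] f = foldr (λ a acc → f a + acc) 0ℚ xs

-- Vertex set V(G) = Fin n.  A labeled complete graph: label v w = true means
-- the edge vw is labelled +, false means -.  Labels are on unordered pairs,
-- hence symmetric.
Labeling : ℕ → Set
Labeling n = Fin n → Fin n → Bool

IsSymmetricLabeling : ∀ {n} → Labeling n → Set
IsSymmetricLabeling {n} lab = ∀ (v w : Fin n) → lab v w ≡ lab w v

-- A fractional clustering: x indexed by unordered pairs (represented as a
-- symmetric function with zero diagonal), values in [0,1], triangle inequality.
record FractionalClustering {n : ℕ} (x : Fin n → Fin n → ℚ) : Set where
  field
    diag-zero : ∀ v → x v v ≡ 0ℚ
    symm      : ∀ v w → x v w ≡ x w v
    lower     : ∀ v w → 0ℚ ≤ x v w
    upper     : ∀ v w → x v w ≤ 1ℚ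
    triangle  : ∀ v w z → x v z ≤ x v w + x w z

VSet : ℕ → Set
VSet n = Fin n → Bool

_≠ᵇ_ : ∀ {n} → Fin n → Fin n → Bool
v ≠ᵇ w = not ⌊ v ≟ w ⌋

_≤ᵇ_ : ℚ → ℚ → Bool
p ≤ᵇ q = ⌊ p ≤? q ⌋

elems : ∀ {n} → VSet n → List (Fin n)
elems {n} S = filterᵇ S (allFin n)

-- { w ∈ S \ {u} : x_{uw} ≤ t }  (T_u for t = α, T*_u for t = γ)
Ball : ∀ {n} → (Fin n → Fin n → ℚ) → ℚ → VSet n → Fin n → List (Fin n)
Ball x t S u = filterᵇ (λ w → (u ≠ᵇ w) ∧ (x u w ≤ᵇ t)) (elems S)

IsPivot : ∀ {n} → (Fin n → Fin n → ℚ) → ℚ → VSet n → Fin n → Set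
IsPivot x γ S u =
  (S u ≡ true) × (∀ v → S v ≡ true → length (Ball x γ S v) ℕ.≤ length (Ball x γ S u))
  where open import Data.Product using (_×_)

_∈ᵇ_ : ∀ {n} → Fin n → List (Fin n) → Bool
w ∈ᵇ xs = foldr (λ a acc → ⌊ w ≟ a ⌋ Data.Bool.∨ acc) false xs
  where import Data.Bool

removeCluster : ∀ {n} → VSet n → Fin n → List (Fin n) → VSet n
removeCluster S u T w = S w ∧ (u ≠ᵇ w) ∧ not (w ∈ᵇ T)

removeVertex : ∀ {n} → VSet n → Fin n → VSet n
removeVertex S u w = S w ∧ (u ≠ᵇ w)

-- The sets S that can occur as the current vertex set at the start of an
-- iteration of Algorithm R (pivot ties resolved arbitrarily).
data Reachable {n : ℕ} (x : Fin n → Fin n → ℚ) (α γ : ℚ) : VSet n → Set where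
  start     : Reachable x α γ (λ _ → true)
  singleton : ∀ {S u} → Reachable x α γ S → IsPivot x γ S u →
              α * ℕ→ℚ (length (Ball x α S u)) ÷ ℕ→ℚ 2 ≤ Σ[ Ball x α S u ] (λ w → x u w) →
              Reachable x α γ (removeVertex S u)
  cluster   : ∀ {S u} → Reachable x α γ S → IsPivot x γ S u →
              Σ[ Ball x α S u ] (λ w → x u w) < α * ℕ→ℚ (length (Ball x α S u)) ÷ ℕ→ℚ 2 →
              Reachable x α γ (removeCluster S u (Ball x α S u))

-- max { 1/(1-2α), 2/α }  (only meaningful for 0 < α < 1/2; 0 otherwise)
bound : ℚ → ℚ
bound α with 0ℚ <? (1ℚ - ℕ→ℚ 2 * α) | 0ℚ <? α
... | yes p | yes q = ((1/ (1ℚ - ℕ→ℚ 2 * α)) {{>-nonZero p}}) ⊔ ((ℕ→ℚ 2 ÷ α) {{>-nonZero q}})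
... | _ | _ = 0ℚ

plusCount : ∀ {n} → Labeling n → Fin n → List (Fin n) → ℕ
plusCount lab z C = length (filterᵇ (lab z) C)

clusterCost : ∀ {n} → Labeling n → (Fin n → Fin n → ℚ) → Fin n → List (Fin n) → ℚ
clusterCost lab x z C =
  Σ[ filterᵇ (lab z) C ] (λ w → x w z) + Σ[ filterᵇ (λ w → not (lab z w)) C ] (λ w → 1ℚ - x w z)

module Submission where

-- Write h = α/2, C = {u} ∪ T and let z be a vertex of S outside C, so that
-- x_uz > α = 2h.  Every w ∈ C has x_uw ≤ α, and the average of x_uw over T is
-- below h.  We charge h to each + edge wz (w ∈ C) against its cost, which is
-- x_wz for a + edge and 1 - x_wz for a - edge, and distinguish two cases.
--   * 2h ≤ x_uz ≤ 1 - h: by the triangle inequality every w ∈ C pays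
--     h·[wz is +] + (h - x_uw) ≤ cost(wz); summing over C, the surplus
--     Σ_C (h - x_uw) = h + (h|T| - Σ_T x_uw) is nonnegative.
--   * x_uz > 1 - h: then x_wz ≥ 1 - 3h ≥ h for every w ∈ C (since 4h ≤ 1),
--     so each + edge already pays h on its own.
-- Hence (α/2)·#{+ edges from z to C} ≤ cost(z, C), and #{+ edges} is at most
-- (2/α)·cost ≤ bound α · cost.

open import Defs
open import Data.Bool using (Bool; true; false; T; if_then_else_; _∧_; not; _∨_)
open import Data.Bool.Properties using (T-≡; T-∧; ∨-zeroʳ)
open import Data.Nat using (ℕ; suc)
open import Data.Integer using () renaming (+_ to ℤ+)
import Data.Nat.Properties as ℕ
import Data.Integer.Properties as ℤ
import Data.Nat.Coprimality as Coprimality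
open import Data.Fin using (Fin; _≟_)
open import Data.List using (List; []; _∷_; length; filterᵇ)
open import Data.List.Relation.Unary.All as All using (All; []; _∷_)
open import Data.List.Relation.Unary.All.Properties using (all-filter)
open import Data.List.Relation.Unary.Any using (here; there)
open import Data.List.Membership.Propositional using (_∈_)
open import Data.List.Membership.Propositional.Properties using (∈-filter⁺; ∈-allFin)
open import Data.Rational using (ℚ; mkℚ; 0ℚ; 1ℚ; ½; _+_; _*_; _-_; -_; 1/_; _÷_; _≤_; _<_; NonZero; >-nonZero; nonNegative; positive)
open import Data.Rational.Properties hiding (_≟_)
open import Data.Rational.Solver using (module +-*-Solver)
open import Data.Product using (_×_; _,_; proj₁; proj₂)
open import Function using (_∘_; Equivalence)
open import Relation.Nullary using (yes; no; ¬_; contradiction)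
open import Relation.Nullary.Decidable using (⌊_⌋; T?; toWitness; fromWitness)
open import Relation.Binary.PropositionalEquality
open +-*-Solver
open Equivalence using (to; from)

ℕ→ℚ-mkℚ : ∀ m → ℕ→ℚ m ≡ mkℚ (ℤ+ m) 0 (Coprimality.sym (Coprimality.1-coprimeTo m))
ℕ→ℚ-mkℚ m = normalize-coprime (Coprimality.sym (Coprimality.1-coprimeTo m))

ℕ→ℚ-suc : ∀ m → ℕ→ℚ (suc m) ≡ 1ℚ + ℕ→ℚ m
ℕ→ℚ-suc m rewrite ℕ→ℚ-mkℚ m | ℕ.*-identityʳ m | ℤ.+◃n≡+n m = refl

ℕ→ℚ-nonNeg : ∀ m → 0ℚ ≤ ℕ→ℚ m
ℕ→ℚ-nonNeg m = nonNegative⁻¹ (ℕ→ℚ m) {{normalize-nonNeg m 1}}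

≤-by-difference : ∀ {a b} d → 0ℚ ≤ d → b - a ≡ d → a ≤ b
≤-by-difference {a} {b} d 0≤d b-a≡d = subst₂ _≤_ (+-identityʳ a) a+d≡b (+-monoʳ-≤ a 0≤d)
  where
  a+d≡b : a + d ≡ b
  a+d≡b = trans (cong (a +_) (sym b-a≡d)) (solve 2 (λ a b → a :+ (b :- a) := b) refl a b)

0≤-difference : ∀ {a b} → a ≤ b → 0ℚ ≤ b - a
0≤-difference {a} {b} a≤b = subst (_≤ b - a) (+-inverseʳ a) (+-monoˡ-≤ (- a) a≤b)

≤-+-nonNeg : ∀ p {q} → 0ℚ ≤ q → p ≤ p + q
≤-+-nonNeg p 0≤q = subst (_≤ p + _) (+-identityʳ p) (+-monoʳ-≤ p 0≤q)

Σ-+ : ∀ {A : Set} (xs : List A) f g → Σ[ xs ] (λ w → f w + g w) ≡ Σ[ xs ] f + Σ[ xs ] g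
Σ-+ [] f g = refl
Σ-+ (a ∷ xs) f g rewrite Σ-+ xs f g =
  solve 4 (λ p q r s → (p :+ q) :+ (r :+ s) := (p :+ r) :+ (q :+ s)) refl
    (f a) (g a) (Σ[ xs ] f) (Σ[ xs ] g)

Σ-scale : ∀ {A : Set} (xs : List A) c f → Σ[ xs ] (λ w → c * f w) ≡ c * Σ[ xs ] f
Σ-scale [] c f = sym (*-zeroʳ c)
Σ-scale (a ∷ xs) c f rewrite Σ-scale xs c f = sym (*-distribˡ-+ c (f a) (Σ[ xs ] f))

Σ-const-minus : ∀ {A : Set} (xs : List A) c f →
                Σ[ xs ] (λ w → c - f w) ≡ c * ℕ→ℚ (length xs) - Σ[ xs ] f
Σ-const-minus [] c f = solve 1 (λ c → con 0ℚ := c :* con 0ℚ :- con 0ℚ) refl c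
Σ-const-minus (a ∷ xs) c f rewrite Σ-const-minus xs c f | ℕ→ℚ-suc (length xs) =
  solve 4 (λ c fa m s → (c :- fa) :+ (c :* m :- s) := c :* (con 1ℚ :+ m) :- (fa :+ s)) refl
    c (f a) (ℕ→ℚ (length xs)) (Σ[ xs ] f)

Σ-mono : ∀ {A : Set} {xs : List A} f g → All (λ w → f w ≤ g w) xs → Σ[ xs ] f ≤ Σ[ xs ] g
Σ-mono f g [] = ≤-refl
Σ-mono f g (p ∷ ps) = +-mono-≤ p (Σ-mono f g ps)

Σ-count : ∀ {A : Set} (xs : List A) (p : A → Bool) →
          ℕ→ℚ (length (filterᵇ p xs)) ≡ Σ[ xs ] (λ w → if p w then 1ℚ else 0ℚ)
Σ-count [] p = refl
Σ-count (a ∷ xs) p with p a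
... | true rewrite ℕ→ℚ-suc (length (filterᵇ p xs)) | Σ-count xs p = refl
... | false rewrite Σ-count xs p = sym (+-identityˡ _)

Σ-split : ∀ {A : Set} (xs : List A) (p : A → Bool) f g →
          Σ[ filterᵇ p xs ] f + Σ[ filterᵇ (λ w → not (p w)) xs ] g
            ≡ Σ[ xs ] (λ w → if p w then f w else g w)
Σ-split [] p f g = refl
Σ-split (a ∷ xs) p f g with p a
... | true rewrite sym (Σ-split xs p f g) =
  +-assoc (f a) (Σ[ filterᵇ p xs ] f) (Σ[ filterᵇ (λ w → not (p w)) xs ] g)
... | false rewrite sym (Σ-split xs p f g) =
  solve 3 (λ a b c → b :+ (a :+ c) := a :+ (b :+ c)) refl
    (g a) (Σ[ filterᵇ p xs ] f) (Σ[ filterᵇ (λ w → not (p w)) xs ] g)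

∈⇒∈ᵇ : ∀ {n} {z : Fin n} {xs} → z ∈ xs → z ∈ᵇ xs ≡ true
∈⇒∈ᵇ {z = z} {_ ∷ xs} (here refl) = cong (_∨ (z ∈ᵇ xs)) (T-≡ .to (fromWitness {a? = z ≟ z} refl))
∈⇒∈ᵇ {z = z} {a ∷ _} (there z∈xs) =
  trans (cong (⌊ z ≟ a ⌋ ∨_) (∈⇒∈ᵇ z∈xs)) (∨-zeroʳ ⌊ z ≟ a ⌋)

Ball-within : ∀ {n} (x : Fin n → Fin n → ℚ) t (S : VSet n) u → All (λ w → x u w ≤ t) (Ball x t S u)
Ball-within x t S u =
  All.map (λ {w} inBall → toWitness {a? = x u w ≤? t} (proj₂ (T-∧ {u ≠ᵇ w} .to inBall)))
          (all-filter (λ w → T? ((u ≠ᵇ w) ∧ (x u w ≤ᵇ t))) (elems S))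

outside-Ball : ∀ {n} (x : Fin n → Fin n → ℚ) t (S : VSet n) u z →
               removeCluster S u (Ball x t S u) z ≡ true → t < x u z
outside-Ball x t S u z left = ≰⇒> x≰t
  where
  z∈S∧rest : T (S z) × T ((u ≠ᵇ z) ∧ not (z ∈ᵇ Ball x t S u))
  z∈S∧rest = T-∧ .to (T-≡ .from left)
  u≠z∧z∉T : T (u ≠ᵇ z) × T (not (z ∈ᵇ Ball x t S u))
  u≠z∧z∉T = T-∧ .to (proj₂ z∈S∧rest)
  x≰t : ¬ x u z ≤ t
  x≰t x≤t = subst (T ∘ not) (∈⇒∈ᵇ z∈T) (proj₂ u≠z∧z∉T)
    where
    z∈T : z ∈ Ball x t S u
    z∈T = ∈-filter⁺ (λ w → T? ((u ≠ᵇ w) ∧ (x u w ≤ᵇ t)))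
            (∈-filter⁺ (T? ∘ S) (∈-allFin z) (proj₁ z∈S∧rest))
            (T-∧ .from (proj₁ u≠z∧z∉T , fromWitness x≤t))

plusIndicator : ∀ {n} → Labeling n → Fin n → Fin n → ℚ
plusIndicator lab z w = if lab z w then 1ℚ else 0ℚ

edgeCost : ∀ {n} → Labeling n → (Fin n → Fin n → ℚ) → Fin n → Fin n → ℚ
edgeCost lab x z w = if lab z w then x w z else 1ℚ - x w z

module Charging {n} (lab : Labeling n) (x : Fin n → Fin n → ℚ) (fc : FractionalClustering x)
                (h : ℚ) (u z : Fin n) where
  open FractionalClustering fc

  -- A + edge uses x_wz ≥ x_uz - x_uw ≥ 2h - x_uw,
  -- a - edge uses 1 - x_wz ≥ 1 - x_uw - x_uz ≥ h - x_uw.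
  moderate-charge : h + h ≤ x u z → x u z ≤ 1ℚ - h →
                    ∀ w → h * plusIndicator lab z w + (h - x u w) ≤ edgeCost lab x z w
  moderate-charge 2h≤d d≤1-h w with lab z w
  ... | true  = ≤-by-difference _
      (+-mono-≤ (0≤-difference (triangle u w z)) (0≤-difference 2h≤d))
      (solve 4 (λ h a b c → b :- (h :* con 1ℚ :+ (h :- a)) := (a :+ b :- c) :+ (c :- (h :+ h))) refl
        h (x u w) (x w z) (x u z))
  ... | false = ≤-by-difference _
      (+-mono-≤ (0≤-difference (subst (λ t → x w z ≤ t + x u z) (symm w u) (triangle w u z)))
                (0≤-difference d≤1-h))
      (solve 4 (λ h a b c → (con 1ℚ :- b) :- (h :* con 0ℚ :+ (h :- a))
                              := (a :+ c :- b) :+ (con 1ℚ :- h :- c)) refl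
        h (x u w) (x w z) (x u z))

  -- Distant case x_uz ≥ 1 - h: a vertex w with x_uw ≤ 2h has x_wz ≥ 1 - 3h ≥ h,
  -- so a + edge wz pays h by itself (and a - edge pays nothing).
  distant-charge : 1ℚ - h ≤ x u z → h + h + h + h ≤ 1ℚ →
                   ∀ w → x u w ≤ h + h → h * plusIndicator lab z w ≤ edgeCost lab x z w
  distant-charge 1-h≤d 4h≤1 w near with lab z w
  ... | true  = ≤-by-difference _
      (+-mono-≤ (+-mono-≤ (0≤-difference (triangle u w z)) (0≤-difference near))
                (+-mono-≤ (0≤-difference 1-h≤d) (0≤-difference 4h≤1)))
      (solve 4 (λ h a b c → b :- h :* con 1ℚ
                  := ((a :+ b :- c) :+ (h :+ h :- a)) :+ ((c :- (con 1ℚ :- h)) :+ (con 1ℚ :- (h :+ h :+ h :+ h))))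
        refl h (x u w) (x w z) (x u z))
  ... | false = subst (_≤ 1ℚ - x w z) (sym (*-zeroʳ h)) (0≤-difference (upper w z))

  charging : 0ℚ ≤ h → h + h + h + h ≤ 1ℚ →
             (L : List (Fin n)) → All (λ w → x u w ≤ h + h) L → Σ[ L ] (x u) ≤ h * ℕ→ℚ (length L) →
             h + h ≤ x u z →
             h * Σ[ u ∷ L ] (plusIndicator lab z) ≤ Σ[ u ∷ L ] (edgeCost lab x z)
  charging 0≤h 4h≤1 L near average 2h≤d with x u z ≤? 1ℚ - h
  ... | yes d≤1-h = ≤-trans (≤-+-nonNeg (h * I) surplus≥0) (subst (_≤ K) charges-sum charges≤K)
    where
    I K surplus : ℚ
    I = Σ[ u ∷ L ] (plusIndicator lab z)
    K = Σ[ u ∷ L ] (edgeCost lab x z)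
    surplus = (h - 0ℚ) + (h * ℕ→ℚ (length L) - Σ[ L ] (x u))
    surplus≥0 : 0ℚ ≤ surplus
    surplus≥0 = +-mono-≤ (0≤-difference 0≤h) (0≤-difference average)
    charges≤K : Σ[ u ∷ L ] (λ w → h * plusIndicator lab z w + (h - x u w)) ≤ K
    charges≤K = Σ-mono {xs = u ∷ L} _ (edgeCost lab x z)
                  (All.tabulate (λ {w} _ → moderate-charge 2h≤d d≤1-h w))
    charges-sum : Σ[ u ∷ L ] (λ w → h * plusIndicator lab z w + (h - x u w)) ≡ h * I + surplus
    charges-sum = begin
      Σ[ u ∷ L ] (λ w → h * plusIndicator lab z w + (h - x u w))
        ≡⟨ Σ-+ (u ∷ L) (λ w → h * plusIndicator lab z w) (λ w → h - x u w) ⟩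
      Σ[ u ∷ L ] (λ w → h * plusIndicator lab z w) + Σ[ u ∷ L ] (λ w → h - x u w)
        ≡⟨ cong₂ _+_ (Σ-scale (u ∷ L) h _)
                     (cong₂ _+_ (cong (λ d → h - d) (diag-zero u)) (Σ-const-minus L h (x u))) ⟩
      h * I + surplus ∎
      where open ≡-Reasoning
  ... | no d≰1-h = subst (_≤ Σ[ u ∷ L ] (edgeCost lab x z)) (Σ-scale (u ∷ L) h _)
      (Σ-mono (λ w → h * plusIndicator lab z w) (edgeCost lab x z)
        (All.map (λ {w} → distant-charge (<⇒≤ (≰⇒> d≰1-h)) 4h≤1 w) (u-near ∷ near)))
    where
    u-near : x u u ≤ h + h
    u-near = subst (_≤ h + h) (sym (diag-zero u)) (+-mono-≤ 0≤h 0≤h)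

cluster-charging : ∀ {n} (lab : Labeling n) (x : Fin n → Fin n → ℚ) → FractionalClustering x →
                   (α : ℚ) → 0ℚ ≤ α → α + α ≤ 1ℚ →
                   (u z : Fin n) (L : List (Fin n)) → All (λ w → x u w ≤ α) L →
                   Σ[ L ] (x u) ≤ α * ℕ→ℚ (length L) ÷ ℕ→ℚ 2 → α ≤ x u z →
                   α * ½ * ℕ→ℚ (plusCount lab z (u ∷ L)) ≤ clusterCost lab x z (u ∷ L)
cluster-charging lab x fc α 0≤α 2α≤1 u z L near average α≤d =
  subst₂ (λ I K → h * I ≤ K) (sym (Σ-count (u ∷ L) (lab z)))
         (sym (Σ-split (u ∷ L) (lab z) (λ w → x w z) (λ w → 1ℚ - x w z)))
    (Charging.charging lab x fc h u z 0≤h 4h≤1 L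
       (All.map (subst (_ ≤_) α≡2h) near)
       (subst (Σ[ L ] (x u) ≤_) (solve 2 (λ a m → a :* m :* con ½ := a :* con ½ :* m) refl α (ℕ→ℚ (length L)))
              average)
       (subst (_≤ x u z) α≡2h α≤d))
  where
  h : ℚ
  h = α * ½
  α≡2h : α ≡ h + h
  α≡2h = sym (trans (solve 1 (λ a → a :* con ½ :+ a :* con ½ := a :* (con ½ :+ con ½)) refl α) (*-identityʳ α))
  0≤h : 0ℚ ≤ h
  0≤h = *-monoʳ-≤-nonNeg ½ 0≤α
  4h≤1 : h + h + h + h ≤ 1ℚ
  4h≤1 = subst (_≤ 1ℚ) (trans (cong₂ _+_ α≡2h α≡2h) (sym (+-assoc (h + h) h h))) 2α≤1

two-over-α≤bound : ∀ α .{{_ : NonZero α}} → 0ℚ < α → α < ½ → ℕ→ℚ 2 ÷ α ≤ bound α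
two-over-α≤bound α 0<α α<½ with 0ℚ <? (1ℚ - ℕ→ℚ 2 * α) | 0ℚ <? α
... | yes 0<1-2α | yes _ = p≤q⊔p ((1/ (1ℚ - ℕ→ℚ 2 * α)) {{>-nonZero 0<1-2α}}) (ℕ→ℚ 2 ÷ α)
... | yes _ | no α≯0 = contradiction 0<α α≯0
... | no 1-2α≯0 | _ = contradiction 0<1-2α 1-2α≯0
  where
  0<1-2α : 0ℚ < 1ℚ - ℕ→ℚ 2 * α
  0<1-2α = subst (_< 1ℚ - ℕ→ℚ 2 * α) (+-inverseʳ (ℕ→ℚ 2 * α))
             (+-monoˡ-< (- (ℕ→ℚ 2 * α))
               (subst (_< 1ℚ) (solve 1 (λ a → a :+ a := con (ℕ→ℚ 2) :* a) refl α) (+-mono-< α<½ α<½)))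

count≤bound*cost : ∀ α → 0ℚ < α → α < ½ → ∀ m K → α * ½ * ℕ→ℚ m ≤ K → ℕ→ℚ m ≤ bound α * K
count≤bound*cost α 0<α α<½ m K charged = begin
  ℕ→ℚ m                          ≡⟨ rescale ⟩
  (ℕ→ℚ 2 ÷ α) * (α * ½ * ℕ→ℚ m)  ≤⟨ *-monoˡ-≤-nonNeg (ℕ→ℚ 2 ÷ α) {{nonNegative 0≤2/α}} charged ⟩
  (ℕ→ℚ 2 ÷ α) * K                ≤⟨ *-monoʳ-≤-nonNeg K {{nonNegative 0≤K}} (two-over-α≤bound α 0<α α<½) ⟩
  bound α * K                    ∎
  where
  open ≤-Reasoning
  instance
    α-positive = positive 0<α
    α≢0 = pos⇒nonZero α
  0≤2/α : 0ℚ ≤ ℕ→ℚ 2 ÷ α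
  0≤2/α = *-monoˡ-≤-nonNeg (ℕ→ℚ 2) (<⇒≤ (positive⁻¹ (1/ α) {{1/pos⇒pos α}}))
  0≤K : 0ℚ ≤ K
  0≤K = ≤-trans (subst (_≤ α * ½ * ℕ→ℚ m) (*-zeroʳ (α * ½))
                  (*-monoˡ-≤-nonNeg (α * ½) {{nonNegative (*-monoʳ-≤-nonNeg ½ (<⇒≤ 0<α))}} (ℕ→ℚ-nonNeg m)))
                charged
  rescale : ℕ→ℚ m ≡ (ℕ→ℚ 2 ÷ α) * (α * ½ * ℕ→ℚ m)
  rescale = sym (trans
    (solve 4 (λ i a k y → con (ℕ→ℚ 2) :* i :* (a :* k :* y) := (a :* i) :* (con (ℕ→ℚ 2) :* k) :* y) refl
      (1/ α) α ½ (ℕ→ℚ m))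
    (trans (cong (λ r → r * (ℕ→ℚ 2 * ½) * ℕ→ℚ m) (*-inverseʳ α)) (*-identityˡ (ℕ→ℚ m))))

lemma5 : (n : ℕ) (lab : Labeling n) → IsSymmetricLabeling lab →
         (x : Fin n → Fin n → ℚ) → FractionalClustering x →
         (α γ : ℚ) → 0ℚ < γ → γ < α → α < ½ →
         (S : VSet n) → Reachable x α γ S →
         (u : Fin n) → IsPivot x γ S u →
         Σ[ Ball x α S u ] (λ w → x u w) < α * ℕ→ℚ (length (Ball x α S u)) ÷ ℕ→ℚ 2 →
         (z : Fin n) → removeCluster S u (Ball x α S u) z ≡ true →
         ℕ→ℚ (plusCount lab z (u ∷ Ball x α S u))
           ≤ bound α * clusterCost lab x z (u ∷ Ball x α S u)
lemma5 n lab _ x fc α γ 0<γ γ<α α<½ S _ u _ small z leftover =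
  count≤bound*cost α 0<α α<½ (plusCount lab z (u ∷ Ball x α S u)) (clusterCost lab x z (u ∷ Ball x α S u))
    (cluster-charging lab x fc α (<⇒≤ 0<α) (<⇒≤ (+-mono-< α<½ α<½))
      u z (Ball x α S u) (Ball-within x α S u) (<⇒≤ small) (<⇒≤ (outside-Ball x α S u z leftover)))
  where
  0<α : 0ℚ < α
  0<α = <-trans 0<γ γ<α
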